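{- Let $n$ be an odd positive integer and let $S\cong\begin{bmatrix} C_n\\ B\end{bmatrix}$ be a linear matrix. Then either $g(S)<n$ or every row of $B$ has either at most one or at least three nonzero entries.
   Context: A $\{0,1\}$-matrix is linear if it has no $2\times2$ submatrix with all entries 1. For $k\ge 3$, $C_k=(c_{ij})$ is the $k\times k$ matrix with $c_{ij}=1$ iff $j\in\{i,i+1\}$ (indices mod $k$). Matrices are congruent ($\cong$) if one arises from the other by permuting rows and columns. $\begin{bmatrix} X\\ Y\end{bmatrix}$ denotes $X$ stacked above $Y$ (same number of columns). $g(A)$ is the least odd $k$ such that $A$ has a submatrix congruent to $C_k$, and $g(A)=\infty$ if none exists. -}

module Defs where

open import Data.Nat using (ℕ; zero; suc; _+_; _*_; _%_; _≡ᵇ_; _≤_; _<_)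
open import Data.Bool using (Bool; true; false; _∨_; if_then_else_)
open import Data.Fin using (Fin; toℕ; splitAt)
import Data.Fin as F
open import Data.Sum using (_⊎_; [_,_])
open import Data.Product using (Σ; _×_; ∃; ∃-syntax; _,_)
open import Relation.Binary.PropositionalEquality using (_≡_; _≢_)
open import Relation.Nullary using (¬_)
open import Function.Definitions using (Injective)
open import Data.Fin.Permutation using (Permutation′; _⟨$⟩ʳ_)

-- {0,1}-matrices with m rows and n columns; true = 1, false = 0.
Matrix : ℕ → ℕ → Set
Matrix m n = Fin m → Fin n → Bool

Odd : ℕ → Set
Odd n = Σ ℕ λ k → n ≡ suc (2 * k)

Linear : ∀ {m n} → Matrix m n → Set
Linear {m} {n} A =
  (i i' : Fin m) (j j' : Fin n) → i ≢ i' → j ≢ j' →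
  ¬ (A i j ≡ true × A i j' ≡ true × A i' j ≡ true × A i' j' ≡ true)

C : (k : ℕ) → Matrix k k
C zero     i j = false
C (suc k)  i j = (toℕ j ≡ᵇ toℕ i) ∨ (toℕ j ≡ᵇ (suc (toℕ i) % suc k))

HasSubmatrixCong : ∀ {m n p q} → Matrix m n → Matrix p q → Set
HasSubmatrixCong {m} {n} {p} {q} A B =
  Σ (Fin p → Fin m) λ r → Σ (Fin q → Fin n) λ c →
    Injective _≡_ _≡_ r × Injective _≡_ _≡_ c ×
    ((i : Fin p) (j : Fin q) → A (r i) (c j) ≡ B i j)

-- g(A) < n  (g(A) = least odd k ≥ 3 with a submatrix ≅ C_k, ∞ if none)
gLt : ∀ {p q} → Matrix p q → ℕ → Set
gLt A n = Σ ℕ λ k → 3 ≤ k × Odd k × k < n × HasSubmatrixCong A (C k)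

stack : ∀ {m m' n} → Matrix m n → Matrix m' n → Matrix (m + m') n
stack {m} X Y i j = [ (λ a → X a j) , (λ b → Y b j) ] (splitAt m i)

Congruent : ∀ {m n} → Matrix m n → Matrix m n → Set
Congruent {m} {n} A B =
  Σ (Permutation′ m) λ σ → Σ (Permutation′ n) λ τ →
    (i : Fin m) (j : Fin n) → A (σ ⟨$⟩ʳ i) (τ ⟨$⟩ʳ j) ≡ B i j

weight : ∀ {n} → (Fin n → Bool) → ℕ
weight {zero}  f = 0
weight {suc n} f = (if f F.zero then 1 else 0) + weight (λ j → f (F.suc j))

-- A row of B with exactly two ones, in columns a < b, closes two cycles with
-- the rows of C_n: going round the n-cycle from column a to column b gives a
-- copy of C_(d+1), and going the other way gives a copy of C_(n-d+1), where
-- d = b - a. Since (d + 1) + (n - d + 1) = n + 2 is odd, one of the two has odd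
-- size k ≤ n, and k = n would force the other cycle to be C_2, i.e. a 2×2 block
-- of ones, which linearity forbids.
module Submission where

open import Defs
open import Data.Nat using (ℕ; zero; suc; _+_; _*_; _∸_; _≡ᵇ_; _≤_; _<_; z≤n; s≤s; s≤s⁻¹; NonZero)
open import Data.Nat.Properties
open import Data.Nat.DivMod
open import Data.Nat.Tactic.RingSolver using (solve-∀)
open import Data.Bool using (Bool; true; false; _∨_)
open import Data.Bool.Properties using (T-≡; ⇔→≡; ∨-comm)
open import Data.Empty using (⊥-elim)
open import Data.Fin using (Fin; toℕ; fromℕ<; join; splitAt)
import Data.Fin as F
open import Data.Fin.Properties using (toℕ<n; toℕ-fromℕ<; toℕ-injective; splitAt-join; any?)
open import Data.Fin.Permutation using (_⟨$⟩ʳ_)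
open import Data.Sum using (_⊎_; inj₁; inj₂; [_,_])
open import Data.Sum.Properties using (inj₁-injective)
open import Data.Product using (Σ; _×_; _,_)
open import Function using (_∘_)
open import Function.Bundles using (_⇔_; mk⇔; Equivalence; Injection)
open import Function.Properties.Inverse using (↔⇒↣)
import Function.Properties.Equivalence as ⇔
open import Relation.Binary.PropositionalEquality using (_≡_; _≢_; refl; sym; trans; cong; cong₂; subst; module ≡-Reasoning)
open import Relation.Nullary using (¬_; yes; no)

≡ᵇ⇔≡ : ∀ {a b} → (a ≡ᵇ b) ≡ true ⇔ a ≡ b
≡ᵇ⇔≡ {a} {b} = mk⇔ (≡ᵇ⇒≡ a b ∘ Equivalence.from T-≡) (Equivalence.to T-≡ ∘ ≡⇒≡ᵇ a b)

≡ᵇ-cong : ∀ {a b c d} → (a ≡ b ⇔ c ≡ d) → (a ≡ᵇ b) ≡ (c ≡ᵇ d)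
≡ᵇ-cong a≡b⇔c≡d = ⇔→≡ (⇔.trans ≡ᵇ⇔≡ (⇔.trans a≡b⇔c≡d (⇔.sym ≡ᵇ⇔≡)))

[m+n%d]%d≡[m+n]%d : ∀ m n d .{{_ : NonZero d}} → (m + n % d) % d ≡ (m + n) % d
[m+n%d]%d≡[m+n]%d m n d = begin
  (m + n % d) % d          ≡⟨ %-distribˡ-+ m (n % d) d ⟩
  (m % d + n % d % d) % d  ≡⟨ cong (λ r → (m % d + r) % d) (m%n%n≡m%n n d) ⟩
  (m % d + n % d) % d      ≡⟨ %-distribˡ-+ m n d ⟨
  (m + n) % d              ∎
  where open ≡-Reasoning

[1+m%d]%d≡[1+m]%d : ∀ m d .{{_ : NonZero d}} → suc (m % d) % d ≡ suc m % d
[1+m%d]%d≡[1+m]%d m d = [m+n%d]%d≡[m+n]%d 1 m d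

rotate-inverse : ∀ {s i} d .{{_ : NonZero d}} → s ≤ d → i < d → (d ∸ s + (s + i) % d) % d ≡ i
rotate-inverse {s} {i} d s≤d i<d = begin
  (d ∸ s + (s + i) % d) % d  ≡⟨ [m+n%d]%d≡[m+n]%d (d ∸ s) (s + i) d ⟩
  (d ∸ s + (s + i)) % d      ≡⟨ cong (_% d) (+-assoc (d ∸ s) s i) ⟨
  (d ∸ s + s + i) % d        ≡⟨ cong (λ r → (r + i) % d) (m∸n+n≡m s≤d) ⟩
  (d + i) % d                ≡⟨ cong (_% d) (+-comm d i) ⟩
  (i + d) % d                ≡⟨ [m+n]%n≡m%n i d ⟩
  i % d                      ≡⟨ m<n⇒m%n≡m i<d ⟩
  i                          ∎
  where open ≡-Reasoning

rotate-≡⇔ : ∀ {s i j} d .{{_ : NonZero d}} → s ≤ d → i < d → j < d →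
  (s + i) % d ≡ (s + j) % d ⇔ i ≡ j
rotate-≡⇔ {s} {i} {j} d s≤d i<d j<d = mk⇔
  (λ eq → trans (sym (rotate-inverse d s≤d i<d))
            (trans (cong (λ r → (d ∸ s + r) % d) eq) (rotate-inverse d s≤d j<d)))
  (cong (λ r → (s + r) % d))

weight≡0⇒≡false : ∀ {n} (f : Fin n → Bool) → weight f ≡ 0 → ∀ z → f z ≡ false
weight≡0⇒≡false {suc n} f w z with f F.zero in f0
weight≡0⇒≡false {suc n} f w F.zero    | false = f0
weight≡0⇒≡false {suc n} f w (F.suc z) | false = weight≡0⇒≡false (f ∘ F.suc) w z

weight≡1⇒one : ∀ {n} (f : Fin n → Bool) → weight f ≡ 1 →
  Σ (Fin n) λ a → ∀ z → f z ≡ (toℕ z ≡ᵇ toℕ a)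
weight≡1⇒one {suc n} f w with f F.zero in f0
... | true  = F.zero , λ where
  F.zero    → f0
  (F.suc z) → weight≡0⇒≡false (f ∘ F.suc) (suc-injective w) z
... | false with weight≡1⇒one (f ∘ F.suc) w
... | a , fa = F.suc a , λ where
  F.zero    → f0
  (F.suc z) → fa z

weight≡2⇒two-ones : ∀ {n} (f : Fin n → Bool) → weight f ≡ 2 →
  Σ (Fin n) λ a → Σ (Fin n) λ b → toℕ a < toℕ b ×
    (∀ z → f z ≡ (toℕ z ≡ᵇ toℕ a) ∨ (toℕ z ≡ᵇ toℕ b))
weight≡2⇒two-ones {suc n} f w with f F.zero in f0
... | true with weight≡1⇒one (f ∘ F.suc) (suc-injective w)
... | b , fb = F.zero , F.suc b , s≤s z≤n , λ where
  F.zero    → f0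
  (F.suc z) → fb z
weight≡2⇒two-ones {suc n} f w | false with weight≡2⇒two-ones (f ∘ F.suc) w
... | a , b , a<b , fab = F.suc a , F.suc b , s≤s a<b , λ where
  F.zero    → f0
  (F.suc z) → fab z

HasSubmatrixCong-trans : ∀ {a b c d p q} {A : Matrix a b} {B : Matrix c d} {X : Matrix p q} →
  HasSubmatrixCong A B → HasSubmatrixCong B X → HasSubmatrixCong A X
HasSubmatrixCong-trans (r , c , r-inj , c-inj , AB) (r′ , c′ , r′-inj , c′-inj , BX) =
  r ∘ r′ , c ∘ c′ , r′-inj ∘ r-inj , c′-inj ∘ c-inj , λ i j → trans (AB (r′ i) (c′ j)) (BX i j)

Congruent⇒HasSubmatrixCong : ∀ {m n} {A B : Matrix m n} → Congruent A B → HasSubmatrixCong A B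
Congruent⇒HasSubmatrixCong (σ , τ , AB) =
  σ ⟨$⟩ʳ_ , τ ⟨$⟩ʳ_ , Injection.injective (↔⇒↣ σ) , Injection.injective (↔⇒↣ τ) , AB

-- C 2 is the all-ones 2×2 matrix.
Linear⇒¬C₂ : ∀ {a b} {A : Matrix a b} → Linear A → ¬ HasSubmatrixCong A (C 2)
Linear⇒¬C₂ lin (r , c , r-inj , c-inj , AC) =
  lin (r 0F) (r 1F) (c 0F) (c 1F) (0F≢1F ∘ r-inj) (0F≢1F ∘ c-inj)
    (AC 0F 0F , AC 0F 1F , AC 1F 0F , AC 1F 1F)
  where
  0F 1F : Fin 2
  0F = F.zero
  1F = F.suc F.zero
  0F≢1F : 0F ≢ 1F
  0F≢1F ()

stack-join : ∀ {m m′ n} (X : Matrix m n) (Y : Matrix m′ n) (r : Fin m ⊎ Fin m′) (j : Fin n) →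
  stack X Y (join m m′ r) j ≡ [ (λ a → X a j) , (λ b → Y b j) ] r
stack-join {m} {m′} X Y r j = cong [ (λ a → X a j) , (λ b → Y b j) ] (splitAt-join m m′ r)

join-injective : ∀ m n {r r′ : Fin m ⊎ Fin n} → join m n r ≡ join m n r′ → r ≡ r′
join-injective m n {r} {r′} eq = trans (sym (splitAt-join m n r)) (trans (cong (splitAt m) eq) (splitAt-join m n r′))

-- Rows x, x+1, …, x+L−1 of C_N (indices mod N) together with a row of B whose
-- ones sit exactly in columns x and y = x+L form a copy of C_(L+1) on the columns
-- x, x+1, …, x+L.
module _ {m n} (B : Matrix m (suc n)) (b : Fin m) {x y : Fin (suc n)}
  (Bb : ∀ z → B b z ≡ (toℕ z ≡ᵇ toℕ y) ∨ (toℕ z ≡ᵇ toℕ x))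
  {L : ℕ} (L<N : L < suc n) (y≡x+L : toℕ y ≡ (toℕ x + L) % suc n) where

  private
    N : ℕ
    N = suc n

    col : ℕ → Fin N
    col t = fromℕ< (m%n<n (toℕ x + t) N)

    toℕ-col : ∀ t → toℕ (col t) ≡ (toℕ x + t) % N
    toℕ-col t = toℕ-fromℕ< (m%n<n (toℕ x + t) N)

    col-≡ᵇ : ∀ {t u} → t < N → u < N → (toℕ (col u) ≡ᵇ toℕ (col t)) ≡ (u ≡ᵇ t)
    col-≡ᵇ t<N u<N = trans (cong₂ _≡ᵇ_ (toℕ-col _) (toℕ-col _))
      (≡ᵇ-cong (rotate-≡⇔ N (<⇒≤ (toℕ<n x)) u<N t<N))

    suc-col : ∀ t → suc (toℕ (col t)) % N ≡ toℕ (col (suc t))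
    suc-col t = begin
      suc (toℕ (col t)) % N      ≡⟨ cong (λ r → suc r % N) (toℕ-col t) ⟩
      suc ((toℕ x + t) % N) % N  ≡⟨ [1+m%d]%d≡[1+m]%d (toℕ x + t) N ⟩
      suc (toℕ x + t) % N        ≡⟨ cong (_% N) (+-suc (toℕ x) t) ⟨
      (toℕ x + suc t) % N        ≡⟨ toℕ-col (suc t) ⟨
      toℕ (col (suc t))          ∎
      where open ≡-Reasoning

    x≡col0 : toℕ x ≡ toℕ (col 0)
    x≡col0 = sym (trans (toℕ-col 0) (trans (cong (_% N) (+-identityʳ (toℕ x))) (m<n⇒m%n≡m (toℕ<n x))))

    y≡colL : toℕ y ≡ toℕ (col L)
    y≡colL = trans y≡x+L (sym (toℕ-col L))

    toℕ<N : (i : Fin (suc L)) → toℕ i < N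
    toℕ<N i = ≤-<-trans (s≤s⁻¹ (toℕ<n i)) L<N

    ≮L⇒≡L : (i : Fin (suc L)) → ¬ toℕ i < L → toℕ i ≡ L
    ≮L⇒≡L i i≮L = ≤-antisym (s≤s⁻¹ (toℕ<n i)) (≮⇒≥ i≮L)

    row : Fin (suc L) → Fin N ⊎ Fin m
    row i with toℕ i <? L
    ... | yes _ = inj₁ (col (toℕ i))
    ... | no  _ = inj₂ b

    col-injective : ∀ {t u} → t < N → u < N → col t ≡ col u → t ≡ u
    col-injective t<N u<N eq = Equivalence.to (rotate-≡⇔ N (<⇒≤ (toℕ<n x)) t<N u<N)
      (trans (sym (toℕ-col _)) (trans (cong toℕ eq) (toℕ-col _)))

    col∘toℕ-injective : ∀ {i j} → col (toℕ i) ≡ col (toℕ j) → i ≡ j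
    col∘toℕ-injective {i} {j} = toℕ-injective ∘ col-injective (toℕ<N i) (toℕ<N j)

    row-injective : ∀ {i j} → row i ≡ row j → i ≡ j
    row-injective {i} {j} eq with toℕ i <? L | toℕ j <? L
    ... | yes _   | yes _   = col∘toℕ-injective (inj₁-injective eq)
    ... | no i≮L | no j≮L = toℕ-injective (trans (≮L⇒≡L i i≮L) (sym (≮L⇒≡L j j≮L)))

    entry : ∀ i j → [ (λ a → C N a (col (toℕ j))) , (λ r → B r (col (toℕ j))) ] (row i) ≡ C (suc L) i j
    entry i j with toℕ i <? L
    ... | yes i<L = cong₂ _∨_ (col-≡ᵇ (toℕ<N i) (toℕ<N j)) (begin
      (toℕ (col (toℕ j)) ≡ᵇ suc (toℕ (col (toℕ i))) % N)  ≡⟨ cong (toℕ (col (toℕ j)) ≡ᵇ_) (suc-col (toℕ i)) ⟩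
      (toℕ (col (toℕ j)) ≡ᵇ toℕ (col (suc (toℕ i))))      ≡⟨ col-≡ᵇ (≤-<-trans i<L L<N) (toℕ<N j) ⟩
      (toℕ j ≡ᵇ suc (toℕ i))                              ≡⟨ cong (toℕ j ≡ᵇ_) (m<n⇒m%n≡m (s≤s i<L)) ⟨
      (toℕ j ≡ᵇ suc (toℕ i) % suc L)                      ∎)
      where open ≡-Reasoning
    ... | no i≮L = begin
      B b (col (toℕ j))                                    ≡⟨ Bb (col (toℕ j)) ⟩
      (toℕ (col (toℕ j)) ≡ᵇ toℕ y) ∨ (toℕ (col (toℕ j)) ≡ᵇ toℕ x)
        ≡⟨ cong₂ (λ p q → (toℕ (col (toℕ j)) ≡ᵇ p) ∨ (toℕ (col (toℕ j)) ≡ᵇ q)) y≡colL x≡col0 ⟩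
      (toℕ (col (toℕ j)) ≡ᵇ toℕ (col L)) ∨ (toℕ (col (toℕ j)) ≡ᵇ toℕ (col 0))
        ≡⟨ cong₂ _∨_ (col-≡ᵇ L<N (toℕ<N j)) (col-≡ᵇ (s≤s z≤n) (toℕ<N j)) ⟩
      (toℕ j ≡ᵇ L) ∨ (toℕ j ≡ᵇ 0)
        ≡⟨ cong₂ (λ p q → (toℕ j ≡ᵇ p) ∨ (toℕ j ≡ᵇ q)) (sym i≡L)
                 (trans (sym (n%n≡0 (suc L))) (cong (λ p → suc p % suc L) (sym i≡L))) ⟩
      C (suc L) i j                                        ∎
      where
      open ≡-Reasoning
      i≡L : toℕ i ≡ L
      i≡L = ≮L⇒≡L i i≮L

  arc-cycle : HasSubmatrixCong (stack (C N) B) (C (suc L))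
  arc-cycle = join N m ∘ row , col ∘ toℕ , row-injective ∘ join-injective N m , col∘toℕ-injective ,
    λ i j → trans (stack-join (C N) B (row i) (col (toℕ j))) (entry i j)

two-ones⇒complementary-cycles : ∀ {m n} (B : Matrix m (suc n)) (b : Fin m) {x y : Fin (suc n)} →
  toℕ x < toℕ y → (∀ z → B b z ≡ (toℕ z ≡ᵇ toℕ x) ∨ (toℕ z ≡ᵇ toℕ y)) →
  Σ ℕ λ d → Σ ℕ λ e → d + e ≡ suc n × 0 < d × 0 < e ×
    HasSubmatrixCong (stack (C (suc n)) B) (C (suc d)) ×
    HasSubmatrixCong (stack (C (suc n)) B) (C (suc e))
two-ones⇒complementary-cycles {n = n} B b {x} {y} x<y Bb =
  d , N ∸ d , m+[n∸m]≡n (<⇒≤ d<N) , m<n⇒0<n∸m x<y , m<n⇒0<n∸m d<N ,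
  arc-cycle B b {x} {y} (λ z → trans (Bb z) (∨-comm (toℕ z ≡ᵇ toℕ x) _)) d<N y≡x+d ,
  arc-cycle B b {y} {x} Bb (∸-monoʳ-< (m<n⇒0<n∸m x<y) (<⇒≤ d<N)) x≡y+e
  where
  N d : ℕ
  N = suc n
  d = toℕ y ∸ toℕ x

  d<N : d < N
  d<N = ≤-<-trans (m∸n≤m (toℕ y) (toℕ x)) (toℕ<n y)

  x+d≡y : toℕ x + d ≡ toℕ y
  x+d≡y = m+[n∸m]≡n (<⇒≤ x<y)

  y≡x+d : toℕ y ≡ (toℕ x + d) % N
  y≡x+d = trans (sym (m<n⇒m%n≡m (toℕ<n y))) (cong (_% N) (sym x+d≡y))

  x≡y+e : toℕ x ≡ (toℕ y + (N ∸ d)) % N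
  x≡y+e = sym (begin
    (toℕ y + (N ∸ d)) % N        ≡⟨ cong (λ r → (r + (N ∸ d)) % N) x+d≡y ⟨
    (toℕ x + d + (N ∸ d)) % N    ≡⟨ cong (_% N) (+-assoc (toℕ x) d (N ∸ d)) ⟩
    (toℕ x + (d + (N ∸ d))) % N  ≡⟨ cong (λ r → (toℕ x + r) % N) (m+[n∸m]≡n (<⇒≤ d<N)) ⟩
    (toℕ x + N) % N              ≡⟨ [m+n]%n≡m%n (toℕ x) N ⟩
    toℕ x % N                    ≡⟨ m<n⇒m%n≡m (toℕ<n x) ⟩
    toℕ x                        ∎)
    where open ≡-Reasoning

Even : ℕ → Set
Even n = Σ ℕ λ h → n ≡ 2 * h

even⊎odd : ∀ n → Even n ⊎ Odd n
even⊎odd zero = inj₁ (0 , refl)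
even⊎odd (suc n) with even⊎odd n
... | inj₁ (h , n≡2h)  = inj₂ (h , cong suc n≡2h)
... | inj₂ (h , n≡2h+1) = inj₁ (suc h , cong suc (trans n≡2h+1 (sym (+-suc h (h + 0)))))

Odd-+⇒Even⊎Even : ∀ d e → Odd (d + e) → Even d ⊎ Even e
Odd-+⇒Even⊎Even d e (k , d+e≡2k+1) with even⊎odd d | even⊎odd e
... | inj₁ even-d | _ = inj₁ even-d
... | inj₂ _ | inj₁ even-e = inj₂ even-e
... | inj₂ (a , d≡2a+1) | inj₂ (b , e≡2b+1) = ⊥-elim (even≢odd (suc (a + b)) k (begin
  2 * suc (a + b)              ≡⟨ odd+odd a b ⟩
  suc (2 * a) + suc (2 * b)    ≡⟨ cong₂ _+_ d≡2a+1 e≡2b+1 ⟨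
  d + e                        ≡⟨ d+e≡2k+1 ⟩
  suc (2 * k)                  ∎))
  where
  open ≡-Reasoning
  odd+odd : ∀ a b → 2 * suc (a + b) ≡ suc (2 * a) + suc (2 * b)
  odd+odd = solve-∀

-- The second cycle only serves to exclude e = 1, where it would be a C_2.
even-arc⇒gLt : ∀ {p q} {S : Matrix p q} {d e} → Linear S → Even d → 0 < d → 0 < e →
  HasSubmatrixCong S (C (suc d)) → HasSubmatrixCong S (C (suc e)) → gLt S (d + e)
even-arc⇒gLt {e = suc zero} lin _ _ _ _ C₂⊆S = ⊥-elim (Linear⇒¬C₂ lin C₂⊆S)
even-arc⇒gLt {d = d} {e = suc (suc e)} _ (h , d≡2h) 0<d _ Cd⊆S _ =
  suc d , s≤s 2≤d , (h , cong suc d≡2h) ,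
  subst (_< d + suc (suc e)) (+-comm d 1) (+-monoʳ-< d (s≤s (s≤s z≤n))) , Cd⊆S
  where
  2≤d : 2 ≤ d
  2≤d = ≤∧≢⇒< 0<d (λ 1≡d → even≢odd h 0 (trans (sym d≡2h) (sym 1≡d)))

complementary-cycles⇒gLt : ∀ {p q} {S : Matrix p q} {N d e} → Linear S → Odd N →
  d + e ≡ N → 0 < d → 0 < e →
  HasSubmatrixCong S (C (suc d)) → HasSubmatrixCong S (C (suc e)) → gLt S N
complementary-cycles⇒gLt {S = S} {d = d} {e} lin odd-N d+e≡N 0<d 0<e Cd⊆S Ce⊆S
  with Odd-+⇒Even⊎Even d e (subst Odd (sym d+e≡N) odd-N)
... | inj₁ even-d = subst (gLt S) d+e≡N (even-arc⇒gLt lin even-d 0<d 0<e Cd⊆S Ce⊆S)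
... | inj₂ even-e = subst (gLt S) (trans (+-comm e d) d+e≡N) (even-arc⇒gLt lin even-e 0<e 0<d Ce⊆S Cd⊆S)

≢2⇒≤1⊎≥3 : ∀ {w} → w ≢ 2 → w ≤ 1 ⊎ 3 ≤ w
≢2⇒≤1⊎≥3 {zero}                _   = inj₁ z≤n
≢2⇒≤1⊎≥3 {suc zero}            _   = inj₁ (s≤s z≤n)
≢2⇒≤1⊎≥3 {suc (suc zero)}      w≢2 = ⊥-elim (w≢2 refl)
≢2⇒≤1⊎≥3 {suc (suc (suc w))}  _   = inj₂ (s≤s (s≤s (s≤s z≤n)))

weight-two-row⇒gLt : ∀ {n m} {S : Matrix (suc n + m) (suc n)} (B : Matrix m (suc n)) →
  Congruent S (stack (C (suc n)) B) → Linear S → Odd (suc n) →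
  (b : Fin m) → weight (B b) ≡ 2 → gLt S (suc n)
weight-two-row⇒gLt {n} {S = S} B S≅CB lin odd-n b weight≡2
  with weight≡2⇒two-ones (B b) weight≡2
... | x , y , x<y , Bb with two-ones⇒complementary-cycles B b x<y Bb
... | d , e , d+e≡n , 0<d , 0<e , Cd⊆CB , Ce⊆CB =
  complementary-cycles⇒gLt lin odd-n d+e≡n 0<d 0<e (⊆S Cd⊆CB) (⊆S Ce⊆CB)
  where
  ⊆S : ∀ {k} → HasSubmatrixCong (stack (C (suc n)) B) (C k) → HasSubmatrixCong S (C k)
  ⊆S = HasSubmatrixCong-trans {A = S} (Congruent⇒HasSubmatrixCong {A = S} S≅CB)

lemma3 : (n m : ℕ) → 0 < n → Odd n →
    (S : Matrix (n + m) n) (B : Matrix m n) →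
    Congruent S (stack (C n) B) → Linear S →
    gLt S n ⊎ ((i : Fin m) → weight (B i) ≤ 1 ⊎ 3 ≤ weight (B i))
lemma3 (suc n) m _ odd-n S B S≅CB lin with any? (λ i → weight (B i) ≟ 2)
... | yes (b , weight≡2) = inj₁ (weight-two-row⇒gLt B S≅CB lin odd-n b weight≡2)
... | no no-weight-2     = inj₂ λ i → ≢2⇒≤1⊎≥3 (no-weight-2 ∘ (i ,_))
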